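{- Let $w\in\mathfrak{S}_N$ avoid the patterns $45231$ and $45132$. If some $N$-occurrence of $3412$ in $w$, consisting of values $a,N,b,c$ appearing in this left-to-right order (so $b<c<a<N$), is such that there is no $k\in\mathrm{newrep}(w)$ with $(a,c)=(M_k,m_k)$, then $w$ has an $N$-occurrence of at least one of the patterns $43512$, $34512$, $35412$.
   Context: Permutations are written in one-line notation; $s_i$ is the simple reflection interchanging $i$ and $i+1$; $\mathrm{supp}(u)$ is the set of distinct simple reflections appearing in a reduced decomposition of $u$. An occurrence of a pattern $p\in\mathfrak{S}_k$ in $w$ is a subsequence $w(i_1)\cdots w(i_k)$, $i_1<\cdots<i_k$, in the same relative order as $p$; it is an $N$-occurrence if its largest value is $N$; $w$ avoids $p$ if it has no occurrence of $p$. For $w\in\mathfrak{S}_N$, $\overline{w}\in\mathfrak{S}_{N-1}$ is obtained by deleting the letter $N$ from the one-line notation of $w$. For $u\in\mathfrak{S}_n$ and $1\le k\le n-1$, $M_k(u)=\max\{u(1),\dots,u(k)\}$, $m_k(u)=\min\{u(k+1),\dots,u(n)\}$; write $M_k=M_k(\overline{w})$, $m_k=m_k(\overline{w})$. Let $\mathrm{newrep}(w)=\{k:\ s_k\in\mathrm{supp}(\overline{w}),\ w^{ -1}(N)\le k\}$. -}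

module Defs where

open import Data.Nat using (ℕ; zero; suc; _+_; _≤_; _<_; _⊔_; _⊓_)
open import Data.Nat.Properties using (_<?_)
open import Data.Fin using (Fin; toℕ) renaming (zero to f0; suc to fs)
open import Data.List using (List; []; _∷_; length; lookup)
open import Data.List.Membership.Propositional using (_∈_)
open import Data.Product using (Σ; _×_; ∃; _,_)
open import Data.Sum using (_⊎_)
open import Relation.Nullary using (¬_; yes; no)
open import Relation.Binary.PropositionalEquality using (_≡_)
open import Function.Bundles using (_⇔_)

-- Permutations of [n] = {1,…,n} are represented (one-line notation) as
-- functions ℕ → ℕ, only their values on 1,…,n being relevant.
IsPerm : ℕ → (ℕ → ℕ) → Set
IsPerm n w =
  (∀ i → 1 ≤ i → i ≤ n → (1 ≤ w i × w i ≤ n)) ×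
  (∀ i j → 1 ≤ i → i ≤ n → 1 ≤ j → j ≤ n → w i ≡ w j → i ≡ j)

record Occurrence (n : ℕ) (w : ℕ → ℕ) (p : List ℕ) : Set where
  field
    pos      : Fin (length p) → ℕ
    pos-low  : ∀ a → 1 ≤ pos a
    pos-high : ∀ a → pos a ≤ n
    pos-incr : ∀ a b → toℕ a < toℕ b → pos a < pos b
    order    : ∀ a b → (w (pos a) < w (pos b)) ⇔ (lookup p a < lookup p b)

-- An N-occurrence: an occurrence whose largest value is N
-- (values of a permutation of [N] are ≤ N, so this means some value equals N).
NOccurrence : (N : ℕ) → (ℕ → ℕ) → List ℕ → Set
NOccurrence N w p =
  Σ (Occurrence N w p) λ o → ∃ λ a → w (Occurrence.pos o a) ≡ N

Avoids : ℕ → (ℕ → ℕ) → List ℕ → Set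
Avoids n w p = ¬ Occurrence n w p

s : ℕ → ℕ → ℕ
s k i with i Data.Nat.≟ k | i Data.Nat.≟ suc k
... | yes _ | _     = suc k
... | no _  | yes _ = k
... | no _  | no _  = i

evalWord : List ℕ → ℕ → ℕ
evalWord []       x = x
evalWord (k ∷ ks) x = s k (evalWord ks x)

IsDecomposition : ℕ → (ℕ → ℕ) → List ℕ → Set
IsDecomposition n u ws =
  (∀ k → k ∈ ws → (1 ≤ k × suc k ≤ n)) ×
  (∀ i → 1 ≤ i → i ≤ n → evalWord ws i ≡ u i)

IsReduced : ℕ → (ℕ → ℕ) → List ℕ → Set
IsReduced n u ws =
  IsDecomposition n u ws ×
  (∀ vs → IsDecomposition n u vs → length ws ≤ length vs)

InSupp : ℕ → (ℕ → ℕ) → ℕ → Set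
InSupp n u k = ∃ λ ws → IsReduced n u ws × k ∈ ws

-- w̄ : delete the letter N (at position j = w⁻¹(N)) from the one-line notation.
wbar : (ℕ → ℕ) → (j : ℕ) → ℕ → ℕ
wbar w j i with i <? j
... | yes _ = w i
... | no _  = w (suc i)

maxUpTo : (ℕ → ℕ) → ℕ → ℕ
maxUpTo u zero    = 0
maxUpTo u (suc k) = maxUpTo u k ⊔ u (suc k)

minRange : (ℕ → ℕ) → ℕ → ℕ → ℕ
minRange u k zero          = 0
minRange u k (suc zero)    = u (suc k)
minRange u k (suc (suc r)) = minRange u k (suc r) ⊓ u (suc k + suc r)

M : (ℕ → ℕ) → ℕ → ℕ
M u k = maxUpTo u k

m : ℕ → (ℕ → ℕ) → ℕ → ℕ
m n u k = minRange u k (n Data.Nat.∸ k)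

InNewrep : (N : ℕ) → (ℕ → ℕ) → (j : ℕ) → ℕ → Set
InNewrep N w j k = InSupp (N Data.Nat.∸ 1) (wbar w j) k × j ≤ k

-- Write a N b c for the given occurrence and let t be the last position before
-- c carrying a value below c. A value strictly between a and N to the left of t
-- completes the occurrence to a 43512, 34512 or 35412, the last one using either
-- b c or w(t) c as its final ascent; a value below c to the right of c would
-- complete a 45231 or 45132. Otherwise, for k = t − 1, every letter among the
-- first k letters of w̄ is at most a and every later one is at least c, so
-- (a, c) = (M_k, m_k); and the descent a > c across position k forces s_k into
-- every decomposition of w̄, so k ∈ newrep(w).

module Submission where

open import Defs
open import Data.Nat using (ℕ; zero; suc; pred; z<s; s<s; >-nonZero; _+_; _<_; _≤_; _∸_; z≤n; s≤s; _≟_; _≤?_; _<?_)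
open import Data.Nat.Properties
open import Data.Nat.Induction using (<-rec)
open import Data.Fin using (Fin; toℕ) renaming (zero to f0; suc to fs)
open import Data.Fin.Properties using (toℕ≤pred[n])
open import Data.List using (List; []; _∷_; length; lookup; _++_; reverse)
open import Data.List.Properties using (unfold-reverse)
open import Data.List.Membership.Propositional using (_∈_; _∉_)
open import Data.List.Membership.DecPropositional _≟_ using (_∈?_)
open import Data.List.Membership.Propositional.Properties using (∈-++⁻)
open import Data.List.Relation.Unary.Any using (here; there)
open import Data.List.Relation.Unary.Any.Properties using (reverse⁻)
open import Data.List.Relation.Unary.All as All using (All; []; _∷_)
open import Data.List.Relation.Unary.Linked using (Linked; []; [-]; _∷_)
open import Data.Product using (_×_; ∃; _,_; proj₁; proj₂)
open import Data.Sum using (_⊎_; inj₁; inj₂; [_,_]′; map₂)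
open import Function using (_∘_)
open import Function.Bundles using (_⇔_; mk⇔; Equivalence)
open import Relation.Nullary using (¬_; Dec; yes; no; contradiction)
open import Relation.Nullary.Decidable using (map′; _×-dec_; _→-dec_)
open import Relation.Unary using (Decidable)
open import Relation.Binary using (tri<; tri≈; tri>)
open import Relation.Binary.PropositionalEquality
  using (_≡_; _≢_; refl; sym; trans; cong; subst; subst₂; module ≡-Reasoning)

StrictlyIncreasing : (ℕ → ℕ) → Set
StrictlyIncreasing f = ∀ i → f i < f (suc i)

module _ {f : ℕ → ℕ} (f↑ : StrictlyIncreasing f) where

  strictlyIncreasing⇒< : ∀ {i j} → i < j → f i < f j
  strictlyIncreasing⇒< {i} {suc j} (s≤s i≤j) with m≤n⇒m<n∨m≡n i≤j
  ... | inj₁ i<j  = <-trans (strictlyIncreasing⇒< i<j) (f↑ j)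
  ... | inj₂ refl = f↑ i

  strictlyIncreasing⇒≤ : ∀ {i j} → i ≤ j → f i ≤ f j
  strictlyIncreasing⇒≤ i≤j with m≤n⇒m<n∨m≡n i≤j
  ... | inj₁ i<j  = <⇒≤ (strictlyIncreasing⇒< i<j)
  ... | inj₂ refl = ≤-refl

  strictlyIncreasing-<⇔< : ∀ {i j} → (f i < f j) ⇔ (i < j)
  strictlyIncreasing-<⇔< {i} {j} = mk⇔ reflects strictlyIncreasing⇒<
    where
    reflects : f i < f j → i < j
    reflects fi<fj with <-cmp i j
    ... | tri< i<j _ _  = i<j
    ... | tri≈ _ refl _ = contradiction fi<fj (<-irrefl refl)
    ... | tri> _ _ j<i  = contradiction (strictlyIncreasing⇒< j<i) (<-asym fi<fj)

-- Enumerates x ∷ xs and then continues by steps of one, so that a strictly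
-- increasing list extends to a strictly increasing function on ℕ.
through : ℕ → List ℕ → ℕ → ℕ
through x []       i       = i + x
through x (y ∷ ys) zero    = x
through x (y ∷ ys) (suc i) = through y ys i

through-strictlyIncreasing : ∀ {x xs} → Linked _<_ (x ∷ xs) → StrictlyIncreasing (through x xs)
through-strictlyIncreasing {x} {[]}         _         i       = n<1+n (i + x)
through-strictlyIncreasing {xs = _ ∷ []}    (x<y ∷ _) zero    = x<y
through-strictlyIncreasing {xs = _ ∷ _ ∷ _} (x<y ∷ _) zero    = x<y
through-strictlyIncreasing {xs = _ ∷ _}     (_ ∷ xs↑) (suc i) = through-strictlyIncreasing xs↑ i

occurrence : ∀ {n w} (p : List ℕ) {pos h : ℕ → ℕ} →
             StrictlyIncreasing pos → StrictlyIncreasing h →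
             1 ≤ pos 0 → pos (pred (length p)) ≤ n →
             (∀ x → w (pos (toℕ x)) ≡ h (lookup p x)) →
             Occurrence n w p
occurrence p {pos} pos↑ h↑ 1≤pos pos≤n w∘pos≡h∘p = record
  { pos      = pos ∘ toℕ
  ; pos-low  = λ x → ≤-trans 1≤pos (strictlyIncreasing⇒≤ pos↑ z≤n)
  ; pos-high = λ x → ≤-trans (strictlyIncreasing⇒≤ pos↑ (toℕ≤pred[n] x)) pos≤n
  ; pos-incr = λ x y → strictlyIncreasing⇒< pos↑
  ; order    = λ x y → subst₂ (λ u v → (u < v) ⇔ _) (sym (w∘pos≡h∘p x)) (sym (w∘pos≡h∘p y))
                                (strictlyIncreasing-<⇔< h↑)
  }

occurrence⁵ : ∀ {n w} l₁ l₂ l₃ l₄ l₅ {q₁ q₂ q₃ q₄ q₅ v₁ v₂ v₃ v₄ v₅} →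
              1 ≤ q₁ → Linked _<_ (q₁ ∷ q₂ ∷ q₃ ∷ q₄ ∷ q₅ ∷ []) → q₅ ≤ n →
              Linked _<_ (0 ∷ v₁ ∷ v₂ ∷ v₃ ∷ v₄ ∷ v₅ ∷ []) →
              let v = through 0 (v₁ ∷ v₂ ∷ v₃ ∷ v₄ ∷ v₅ ∷ []) in
              w q₁ ≡ v l₁ → w q₂ ≡ v l₂ → w q₃ ≡ v l₃ → w q₄ ≡ v l₄ → w q₅ ≡ v l₅ →
              Occurrence n w (l₁ ∷ l₂ ∷ l₃ ∷ l₄ ∷ l₅ ∷ [])
occurrence⁵ l₁ l₂ l₃ l₄ l₅ 1≤q₁ q↑ q₅≤n v↑ e₁ e₂ e₃ e₄ e₅ =
  occurrence (l₁ ∷ l₂ ∷ l₃ ∷ l₄ ∷ l₅ ∷ [])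
    (through-strictlyIncreasing q↑) (through-strictlyIncreasing v↑) 1≤q₁ q₅≤n
    λ { f0 → e₁ ; (fs f0) → e₂ ; (fs (fs f0)) → e₃ ; (fs (fs (fs f0))) → e₄
      ; (fs (fs (fs (fs f0)))) → e₅ }

module _ {P : ℕ → Set} (P? : Decidable P) where

  Least : Set
  Least = ∃ λ l → P l × (∀ {l′} → l′ < l → ¬ P l′)

  least : ∀ {n} → P n → Least
  least {n} = <-rec (λ n → P n → Least) step n
    where
    step : ∀ n → (∀ {l} → l < n → P l → Least) → P n → Least
    step n rec Pn with anyUpTo? P? n
    ... | yes (l , l<n , Pl) = rec l<n Pl
    ... | no none            = n , Pn , λ l<n Pl → none (_ , l<n , Pl)

  greatest : ∀ {b B} → b < B → P b →
             ∃ λ t → b ≤ t × t < B × P t × (∀ {r} → t < r → r < B → ¬ P r)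
  greatest {b} {suc B} b<1+B Pb with P? B | m≤n⇒m<n∨m≡n (≤-pred b<1+B)
  ... | yes PB | _         = B , ≤-pred b<1+B , ≤-refl , PB ,
                             λ B<r r<1+B → contradiction (≤-pred r<1+B) (<⇒≱ B<r)
  ... | no ¬PB | inj₂ refl = contradiction Pb ¬PB
  ... | no ¬PB | inj₁ b<B  with greatest b<B Pb
  ...   | t , b≤t , t<B , Pt , none = t , b≤t , m≤n⇒m≤1+n t<B , Pt ,
          λ t<r r<1+B → [ none t<r , (λ { refl → ¬PB }) ]′ (m≤n⇒m<n∨m≡n (≤-pred r<1+B))

s-k : ∀ k → s k k ≡ suc k
s-k k with k ≟ k | k ≟ suc k
... | yes _   | _ = refl
... | no k≢k  | _ = contradiction refl k≢k

s-suc : ∀ k → s k (suc k) ≡ k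
s-suc k with suc k ≟ k | suc k ≟ suc k
... | yes 1+k≡k | _          = contradiction 1+k≡k 1+n≢n
... | no _      | yes _      = refl
... | no _      | no 1+k≢1+k = contradiction refl 1+k≢1+k

s-fixes : ∀ {k x} → x ≢ k → x ≢ suc k → s k x ≡ x
s-fixes {k} {x} x≢k x≢1+k with x ≟ k | x ≟ suc k
... | yes x≡k | _          = contradiction x≡k x≢k
... | no _    | yes x≡1+k  = contradiction x≡1+k x≢1+k
... | no _    | no _       = refl

data Position (k x : ℕ) : Set where
  at-k      : x ≡ k → Position k x
  at-suc-k  : x ≡ suc k → Position k x
  elsewhere : x ≢ k → x ≢ suc k → Position k x

position : ∀ k x → Position k x
position k x with x ≟ k | x ≟ suc k
... | yes x≡k | _          = at-k x≡k
... | no _    | yes x≡1+k  = at-suc-k x≡1+k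
... | no x≢k  | no x≢1+k   = elsewhere x≢k x≢1+k

s-involutive : ∀ k x → s k (s k x) ≡ x
s-involutive k x with position k x
... | at-k refl           = trans (cong (s k) (s-k k)) (s-suc k)
... | at-suc-k refl       = trans (cong (s k) (s-suc k)) (s-k k)
... | elsewhere x≢k x≢1+k = trans (cong (s k) (s-fixes x≢k x≢1+k)) (s-fixes x≢k x≢1+k)

Letter : ℕ → ℕ → Set
Letter n k = 1 ≤ k × suc k ≤ n

Letters : ℕ → List ℕ → Set
Letters n ws = ∀ k → k ∈ ws → Letter n k

letter? : ∀ n k → Dec (Letter n k)
letter? n k = (1 ≤? k) ×-dec (suc k ≤? n)

s-preserves-range : ∀ {n k x} → Letter n k → 1 ≤ x → x ≤ n → 1 ≤ s k x × s k x ≤ n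
s-preserves-range {n} {k} {x} (1≤k , 1+k≤n) 1≤x x≤n with position k x
... | at-k refl           rewrite s-k k   = s≤s z≤n , 1+k≤n
... | at-suc-k refl       rewrite s-suc k = 1≤k , ≤-trans (n≤1+n k) 1+k≤n
... | elsewhere x≢k x≢1+k rewrite s-fixes x≢k x≢1+k = 1≤x , x≤n

evalWord-++ : ∀ xs ys x → evalWord (xs ++ ys) x ≡ evalWord xs (evalWord ys x)
evalWord-++ []       ys x = refl
evalWord-++ (k ∷ xs) ys x = cong (s k) (evalWord-++ xs ys x)

evalWord-reverse-inverse : ∀ ws x → evalWord (reverse ws) (evalWord ws x) ≡ x
evalWord-reverse-inverse []       x = refl
evalWord-reverse-inverse (k ∷ ks) x = begin
  evalWord (reverse (k ∷ ks)) y                  ≡⟨ cong (λ vs → evalWord vs y) (unfold-reverse k ks) ⟩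
  evalWord (reverse ks ++ k ∷ []) y              ≡⟨ evalWord-++ (reverse ks) (k ∷ []) y ⟩
  evalWord (reverse ks) (s k y)                  ≡⟨ cong (evalWord (reverse ks)) (s-involutive k _) ⟩
  evalWord (reverse ks) (evalWord ks x)          ≡⟨ evalWord-reverse-inverse ks x ⟩
  x                                              ∎
  where
  open ≡-Reasoning
  y = s k (evalWord ks x)

evalWord-injective : ∀ ws {x y} → evalWord ws x ≡ evalWord ws y → x ≡ y
evalWord-injective ws {x} {y} eq = begin
  x                                      ≡⟨ evalWord-reverse-inverse ws x ⟨
  evalWord (reverse ws) (evalWord ws x)  ≡⟨ cong (evalWord (reverse ws)) eq ⟩
  evalWord (reverse ws) (evalWord ws y)  ≡⟨ evalWord-reverse-inverse ws y ⟩
  y                                      ∎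
  where open ≡-Reasoning

letters-tail : ∀ {n k ws} → Letters n (k ∷ ws) → Letters n ws
letters-tail letters l l∈ws = letters l (there l∈ws)

evalWord-preserves-range : ∀ {n} ws → Letters n ws → ∀ {x} → 1 ≤ x → x ≤ n →
                           1 ≤ evalWord ws x × evalWord ws x ≤ n
evalWord-preserves-range []       _       1≤x x≤n = 1≤x , x≤n
evalWord-preserves-range (k ∷ ws) letters 1≤x x≤n =
  let 1≤y , y≤n = evalWord-preserves-range ws (letters-tail letters) 1≤x x≤n
  in s-preserves-range (letters k (here refl)) 1≤y y≤n

evalWord-fixes-suc : ∀ {n} ws → Letters n ws → evalWord ws (suc n) ≡ suc n
evalWord-fixes-suc         []       _       = refl
evalWord-fixes-suc {n} (k ∷ ws) letters =
  trans (cong (s k) (evalWord-fixes-suc ws (letters-tail letters)))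
        (s-fixes (>⇒≢ (m≤n⇒m≤1+n 1+k≤n)) (>⇒≢ (s≤s 1+k≤n)))
  where 1+k≤n = proj₂ (letters k (here refl))

climb : ℕ → ℕ → List ℕ
climb r zero    = []
climb r (suc d) = r + d ∷ climb r d

climb-carries : ∀ r d → evalWord (climb r d) r ≡ r + d
climb-carries r zero    = sym (+-identityʳ r)
climb-carries r (suc d) = begin
  s (r + d) (evalWord (climb r d) r)  ≡⟨ cong (s (r + d)) (climb-carries r d) ⟩
  s (r + d) (r + d)                   ≡⟨ s-k (r + d) ⟩
  suc (r + d)                         ≡⟨ +-suc r d ⟨
  r + suc d                           ∎
  where open ≡-Reasoning

climb-letters : ∀ {r} d → 1 ≤ r → Letters (r + d) (climb r d)
climb-letters {r} (suc d) 1≤r k (here refl) = ≤-trans 1≤r (m≤m+n r d) , ≤-reflexive (sym (+-suc r d))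
climb-letters {r} (suc d) 1≤r k (there k∈) =
  let 1≤k , 1+k≤r+d = climb-letters d 1≤r k k∈ in 1≤k , ≤-trans 1+k≤r+d (+-monoʳ-≤ r (n≤1+n d))

letters-weaken : ∀ {n ws} → Letters n ws → Letters (suc n) ws
letters-weaken letters k k∈ = let 1≤k , 1+k≤n = letters k k∈ in 1≤k , m≤n⇒m≤1+n 1+k≤n

letters-reverse : ∀ {n} ws → Letters n ws → Letters n (reverse ws)
letters-reverse ws letters k k∈ = letters k (reverse⁻ k∈)

letters-++ : ∀ {n} xs {ys} → Letters n xs → Letters n ys → Letters n (xs ++ ys)
letters-++ xs lxs lys k k∈ = [ lxs k , lys k ]′ (∈-++⁻ xs k∈)

perm-∘-word : ∀ {n u} c → Letters n c → IsPerm n u → IsPerm n (evalWord c ∘ u)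
perm-∘-word c letters (range , injective) =
  (λ i 1≤i i≤n → let 1≤ui , ui≤n = range i 1≤i i≤n in evalWord-preserves-range c letters 1≤ui ui≤n) ,
  (λ i j 1≤i i≤n 1≤j j≤n eq → injective i j 1≤i i≤n 1≤j j≤n (evalWord-injective c eq))

perm-restrict : ∀ {n v} → IsPerm (suc n) v → v (suc n) ≡ suc n → IsPerm n v
perm-restrict {n} {v} (range , injective) v[1+n]≡1+n = range′ , injective′
  where
  injective′ : ∀ i j → 1 ≤ i → i ≤ n → 1 ≤ j → j ≤ n → v i ≡ v j → i ≡ j
  injective′ i j 1≤i i≤n 1≤j j≤n = injective i j 1≤i (m≤n⇒m≤1+n i≤n) 1≤j (m≤n⇒m≤1+n j≤n)
  range′ : ∀ i → 1 ≤ i → i ≤ n → 1 ≤ v i × v i ≤ n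
  range′ i 1≤i i≤n =
    let 1≤vi , vi≤1+n = range i 1≤i (m≤n⇒m≤1+n i≤n)
        vi≢1+n = λ vi≡1+n → <⇒≢ (s≤s i≤n)
                   (injective i (suc n) 1≤i (m≤n⇒m≤1+n i≤n) (s≤s z≤n) ≤-refl (trans vi≡1+n (sym v[1+n]≡1+n)))
    in 1≤vi , ≤-pred (≤∧≢⇒< vi≤1+n vi≢1+n)

-- Induction on n: a climb word moves u(n+1) to n+1, the rest is a permutation of [n].
decomposition-exists : ∀ n {u} → IsPerm n u → ∃ (IsDecomposition n u)
decomposition-exists zero    _ = [] , (λ _ ()) , λ i 1≤i i≤0 → contradiction (≤-trans 1≤i i≤0) λ ()
decomposition-exists (suc n) {u} perm@(range , _) =
  reverse c ++ ws , letters-++ (reverse c) (letters-reverse c c-letters) (letters-weaken ws-letters) , eval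
  where
  r = u (suc n)
  1≤r = proj₁ (range (suc n) (s≤s z≤n) ≤-refl)
  r+d≡1+n : r + (suc n ∸ r) ≡ suc n
  r+d≡1+n = m+[n∸m]≡n (proj₂ (range (suc n) (s≤s z≤n) ≤-refl))
  c = climb r (suc n ∸ r)
  c-letters : Letters (suc n) c
  c-letters = subst (λ m → Letters m c) r+d≡1+n (climb-letters (suc n ∸ r) 1≤r)
  v = evalWord c ∘ u
  v[1+n]≡1+n : v (suc n) ≡ suc n
  v[1+n]≡1+n = trans (climb-carries r (suc n ∸ r)) r+d≡1+n
  ih = decomposition-exists n (perm-restrict (perm-∘-word c c-letters perm) v[1+n]≡1+n)
  ws = proj₁ ih
  ws-letters = proj₁ (proj₂ ih)
  ws-eval : ∀ i → 1 ≤ i → i ≤ suc n → evalWord ws i ≡ v i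
  ws-eval i 1≤i i≤1+n with m≤n⇒m<n∨m≡n i≤1+n
  ... | inj₁ i<1+n = proj₂ (proj₂ ih) i 1≤i (≤-pred i<1+n)
  ... | inj₂ refl  = trans (evalWord-fixes-suc ws ws-letters) (sym v[1+n]≡1+n)
  eval : ∀ i → 1 ≤ i → i ≤ suc n → evalWord (reverse c ++ ws) i ≡ u i
  eval i 1≤i i≤1+n = begin
    evalWord (reverse c ++ ws) i          ≡⟨ evalWord-++ (reverse c) ws i ⟩
    evalWord (reverse c) (evalWord ws i)  ≡⟨ cong (evalWord (reverse c)) (ws-eval i 1≤i i≤1+n) ⟩
    evalWord (reverse c) (v i)            ≡⟨ evalWord-reverse-inverse c (u i) ⟩
    u i                                   ∎
    where open ≡-Reasoning

words? : ∀ n l {P : List ℕ → Set} → Decidable P →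
         Dec (∃ λ ws → length ws ≡ l × All (Letter n) ws × P ws)
words? n zero    P? = map′ (λ p → [] , refl , [] , p) (λ { ([] , _ , _ , p) → p }) (P? [])
words? n (suc l) {P} P? =
  map′ (λ (k , _ , k-letter , ws , |ws|≡l , letters , p) →
          k ∷ ws , cong suc |ws|≡l , k-letter ∷ letters , p)
       (λ { (k ∷ ws , |ws|≡l , k-letter ∷ letters , p) →
          k , proj₂ k-letter , k-letter , ws , suc-injective |ws|≡l , letters , p })
       (anyUpTo? (λ k → letter? n k ×-dec words? n l {λ ws → P (k ∷ ws)} (P? ∘ (k ∷_))) n)

decomposition-of-length? : ∀ n u l → Dec (∃ λ ws → length ws ≡ l × IsDecomposition n u ws)
decomposition-of-length? n u l =
  map′ (λ (ws , |ws|≡l , letters , eval) →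
          ws , |ws|≡l , (λ _ → All.lookup letters) , λ i 1≤i i≤n → eval (s≤s i≤n) 1≤i)
       (λ (ws , |ws|≡l , letters , eval) →
          ws , |ws|≡l , All.tabulate (letters _) , λ {i} i<1+n 1≤i → eval i 1≤i (≤-pred i<1+n))
       (words? n l (λ ws → allUpTo? (λ i → (1 ≤? i) →-dec (evalWord ws i ≟ u i)) (suc n)))

-- Letters being bounded, having a decomposition of length l is decidable, so a
-- shortest decomposition can be found below the length of any given one.
reduced-exists : ∀ n {u} → IsPerm n u → ∃ (IsReduced n u)
reduced-exists n {u} perm =
  let ws₀ , dec₀ = decomposition-exists n perm
      _ , (ws , |ws|≡l , dec) , shorter-impossible = least (decomposition-of-length? n u) (ws₀ , refl , dec₀)
  in ws , dec , λ vs dec-vs → ≮⇒≥ λ |vs|<|ws| →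
       shorter-impossible (subst (length vs <_) |ws|≡l |vs|<|ws|) (vs , refl , dec-vs)

s-preserves-≤ : ∀ {l k y} → l ≢ k → y ≤ k → s l y ≤ k
s-preserves-≤ {l} {k} {y} l≢k y≤k with position l y
... | at-k refl           rewrite s-k l   = ≤∧≢⇒< y≤k l≢k
... | at-suc-k refl       rewrite s-suc l = ≤-trans (n≤1+n l) y≤k
... | elsewhere y≢l y≢1+l rewrite s-fixes y≢l y≢1+l = y≤k

s-preserves-> : ∀ {l k y} → l ≢ k → k < y → k < s l y
s-preserves-> {l} {k} {y} l≢k k<y with position l y
... | at-k refl           rewrite s-k l   = m≤n⇒m≤1+n k<y
... | at-suc-k refl       rewrite s-suc l = ≤∧≢⇒< (≤-pred k<y) (l≢k ∘ sym)
... | elsewhere y≢l y≢1+l rewrite s-fixes y≢l y≢1+l = k<y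

evalWord-preserves-≤ : ∀ {k} ws → k ∉ ws → ∀ {x} → x ≤ k → evalWord ws x ≤ k
evalWord-preserves-≤ []       _   x≤k = x≤k
evalWord-preserves-≤ (l ∷ ws) k∉ x≤k =
  s-preserves-≤ (k∉ ∘ here ∘ sym) (evalWord-preserves-≤ ws (k∉ ∘ there) x≤k)

evalWord-preserves-> : ∀ {k} ws → k ∉ ws → ∀ {x} → k < x → k < evalWord ws x
evalWord-preserves-> []       _   k<x = k<x
evalWord-preserves-> (l ∷ ws) k∉ k<x =
  s-preserves-> (k∉ ∘ here ∘ sym) (evalWord-preserves-> ws (k∉ ∘ there) k<x)

-- A word without sₖ preserves {1,…,k}, so it cannot produce a descent across k.
descent⇒∈ : ∀ {n u ws k x y} → IsDecomposition n u ws →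
            1 ≤ x → x ≤ k → k < y → y ≤ n → u y < u x → k ∈ ws
descent⇒∈ {u = u} {ws} {k} {x} {y} (_ , eval) 1≤x x≤k k<y y≤n uy<ux with k ∈? ws
... | yes k∈ = k∈
... | no k∉  = contradiction uy<ux (≤⇒≯ (begin
      u x              ≡⟨ eval x 1≤x (≤-trans x≤k (≤-trans (n≤1+n k) (≤-trans k<y y≤n))) ⟨
      evalWord ws x    ≤⟨ evalWord-preserves-≤ ws k∉ x≤k ⟩
      k                <⟨ evalWord-preserves-> ws k∉ k<y ⟩
      evalWord ws y    ≡⟨ eval y (≤-trans (s≤s z≤n) k<y) y≤n ⟩
      u y              ∎))
  where open ≤-Reasoning

descent⇒InSupp : ∀ {n u k x y} → IsPerm n u →
                 1 ≤ x → x ≤ k → k < y → y ≤ n → u y < u x → InSupp n u k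
descent⇒InSupp {n} perm 1≤x x≤k k<y y≤n uy<ux =
  let ws , reduced = reduced-exists n perm
  in ws , reduced , descent⇒∈ (proj₁ reduced) 1≤x x≤k k<y y≤n uy<ux

-- The position in w of the i-th letter of w̄.
punchIn : ℕ → ℕ → ℕ
punchIn j i with i <? j
... | yes _ = i
... | no _  = suc i

wbar≡w∘punchIn : ∀ w j i → wbar w j i ≡ w (punchIn j i)
wbar≡w∘punchIn w j i with i <? j
... | yes _ = refl
... | no _  = refl

punchIn-cases : ∀ j i → (i < j × punchIn j i ≡ i) ⊎ (j ≤ i × punchIn j i ≡ suc i)
punchIn-cases j i with i <? j
... | yes i<j = inj₁ (i<j , refl)
... | no i≮j  = inj₂ (≮⇒≥ i≮j , refl)

punchIn-≢ : ∀ j i → punchIn j i ≢ j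
punchIn-≢ j i with punchIn-cases j i
... | inj₁ (i<j , eq) = <⇒≢ (subst (_< j) (sym eq) i<j)
... | inj₂ (j≤i , eq) = >⇒≢ (subst (j <_) (sym eq) (s≤s j≤i))

punchIn-injective : ∀ j {i i′} → punchIn j i ≡ punchIn j i′ → i ≡ i′
punchIn-injective j {i} {i′} eq with punchIn-cases j i | punchIn-cases j i′
... | inj₁ (_ , e) | inj₁ (_ , e′) = trans (sym e) (trans eq e′)
... | inj₂ (_ , e) | inj₂ (_ , e′) = suc-injective (trans (sym e) (trans eq e′))
... | inj₁ (i<j , e) | inj₂ (j≤i′ , e′) =
  contradiction (trans (sym e) (trans eq e′)) (<⇒≢ (<-≤-trans i<j (m≤n⇒m≤1+n j≤i′)))
... | inj₂ (j≤i , e) | inj₁ (i′<j , e′) =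
  contradiction (trans (sym e′) (trans (sym eq) e)) (<⇒≢ (<-≤-trans i′<j (m≤n⇒m≤1+n j≤i)))

punchIn-bounds : ∀ j i → i ≤ punchIn j i × punchIn j i ≤ suc i
punchIn-bounds j i with punchIn-cases j i
... | inj₁ (_ , eq) = ≤-reflexive (sym eq) , ≤-trans (≤-reflexive eq) (n≤1+n i)
... | inj₂ (_ , eq) = ≤-trans (n≤1+n i) (≤-reflexive (sym eq)) , ≤-reflexive eq

wbar-< : ∀ w {j i} → i < j → wbar w j i ≡ w i
wbar-< w {j} {i} i<j with i <? j
... | yes _   = refl
... | no i≮j  = contradiction i<j i≮j

wbar-≥ : ∀ w {j i} → j ≤ i → wbar w j i ≡ w (suc i)
wbar-≥ w {j} {i} j≤i with i <? j
... | yes i<j = contradiction j≤i (<⇒≱ i<j)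
... | no _    = refl

wbar-perm : ∀ {N w j} → IsPerm N w → 1 ≤ j → j ≤ N → w j ≡ N → IsPerm (N ∸ 1) (wbar w j)
wbar-perm {zero}        _ 1≤j j≤0 _ = contradiction (≤-trans 1≤j j≤0) λ ()
wbar-perm {suc n} {w} {j} (range , injective) 1≤j j≤N wj≡N = range′ , injective′
  where
  in-range : ∀ {i} → 1 ≤ i → i ≤ n → 1 ≤ punchIn j i × punchIn j i ≤ suc n
  in-range {i} 1≤i i≤n =
    let i≤p , p≤1+i = punchIn-bounds j i in ≤-trans 1≤i i≤p , ≤-trans p≤1+i (s≤s i≤n)
  range′ : ∀ i → 1 ≤ i → i ≤ n → 1 ≤ wbar w j i × wbar w j i ≤ n
  range′ i 1≤i i≤n rewrite wbar≡w∘punchIn w j i =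
    let 1≤p , p≤N = in-range 1≤i i≤n
        1≤wp , wp≤N = range (punchIn j i) 1≤p p≤N
        wp≢N = λ wp≡N → punchIn-≢ j i (injective _ j 1≤p p≤N 1≤j j≤N (trans wp≡N (sym wj≡N)))
    in 1≤wp , ≤-pred (≤∧≢⇒< wp≤N wp≢N)
  injective′ : ∀ i i′ → 1 ≤ i → i ≤ n → 1 ≤ i′ → i′ ≤ n → wbar w j i ≡ wbar w j i′ → i ≡ i′
  injective′ i i′ 1≤i i≤n 1≤i′ i′≤n eq rewrite wbar≡w∘punchIn w j i | wbar≡w∘punchIn w j i′ =
    let 1≤p , p≤N = in-range 1≤i i≤n ; 1≤p′ , p′≤N = in-range 1≤i′ i′≤n
    in punchIn-injective j (injective _ _ 1≤p p≤N 1≤p′ p′≤N eq)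

maxUpTo-lub : ∀ u {a} k → (∀ i → 1 ≤ i → i ≤ k → u i ≤ a) → maxUpTo u k ≤ a
maxUpTo-lub u zero    _     = z≤n
maxUpTo-lub u (suc k) bound =
  ⊔-lub (maxUpTo-lub u k λ i 1≤i i≤k → bound i 1≤i (m≤n⇒m≤1+n i≤k)) (bound (suc k) (s≤s z≤n) ≤-refl)

maxUpTo-ub : ∀ u {i} k → 1 ≤ i → i ≤ k → u i ≤ maxUpTo u k
maxUpTo-ub u zero    1≤i i≤0 = contradiction (≤-trans 1≤i i≤0) λ ()
maxUpTo-ub u {i} (suc k) 1≤i i≤1+k with m≤n⇒m<n∨m≡n i≤1+k
... | inj₁ i<1+k = ≤-trans (maxUpTo-ub u k 1≤i (≤-pred i<1+k)) (m≤m⊔n (maxUpTo u k) (u (suc k)))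
... | inj₂ refl  = m≤n⊔m (maxUpTo u k) (u (suc k))

M≡ : ∀ u {a i₀} k → (∀ i → 1 ≤ i → i ≤ k → u i ≤ a) → 1 ≤ i₀ → i₀ ≤ k → u i₀ ≡ a → M u k ≡ a
M≡ u k bound 1≤i₀ i₀≤k ui₀≡a =
  ≤-antisym (maxUpTo-lub u k bound) (subst (_≤ maxUpTo u k) ui₀≡a (maxUpTo-ub u k 1≤i₀ i₀≤k))

minRange-glb : ∀ u {c} k r → (∀ i → k < i → i ≤ k + suc r → c ≤ u i) → c ≤ minRange u k (suc r)
minRange-glb u k zero    bound = bound (suc k) ≤-refl (≤-reflexive (+-comm 1 k))
minRange-glb u k (suc r) bound =
  ⊓-glb (minRange-glb u k r λ i k<i i≤ → bound i k<i (≤-trans i≤ (+-monoʳ-≤ k (n≤1+n (suc r)))))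
        (bound (suc k + suc r) (s≤s (m≤m+n k (suc r))) (≤-reflexive (sym (+-suc k (suc r)))))

minRange-lb : ∀ u {i} k r → k < i → i ≤ k + suc r → minRange u k (suc r) ≤ u i
minRange-lb u {i} k zero k<i i≤ with ≤-antisym (≤-trans i≤ (≤-reflexive (+-comm k 1))) k<i
... | refl = ≤-refl
minRange-lb u {i} k (suc r) k<i i≤ with m≤n⇒m<n∨m≡n (≤-trans i≤ (≤-reflexive (+-suc k (suc r))))
... | inj₁ i<  = ≤-trans (m⊓n≤m _ _) (minRange-lb u k r k<i (≤-pred i<))
... | inj₂ refl = m⊓n≤n _ _

m≡ : ∀ n u {c i₀} k → (∀ i → k < i → i ≤ n → c ≤ u i) → k < i₀ → i₀ ≤ n → u i₀ ≡ c → m n u k ≡ c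
m≡ zero    u k bound k<i₀ i₀≤0 = contradiction (<-≤-trans k<i₀ i₀≤0) λ ()
m≡ (suc n) u {i₀ = i₀} k bound k<i₀ i₀≤1+n ui₀≡c
  rewrite +-∸-assoc 1 (≤-pred (<-≤-trans k<i₀ i₀≤1+n)) =
  ≤-antisym (subst (minRange u k (suc (n ∸ k)) ≤_) ui₀≡c
                   (minRange-lb u k (n ∸ k) k<i₀ (subst (i₀ ≤_) (sym k+[1+n-k]≡1+n) i₀≤1+n)))
            (minRange-glb u k (n ∸ k) λ i k<i i≤ → bound i k<i (subst (i ≤_) k+[1+n-k]≡1+n i≤))
  where
  k+[1+n-k]≡1+n : k + suc (n ∸ k) ≡ suc n
  k+[1+n-k]≡1+n = trans (+-suc k (n ∸ k)) (cong suc (m+[n∸m]≡n (≤-pred (<-≤-trans k<i₀ i₀≤1+n))))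

≤∸1⇒< : ∀ {i n} → 1 ≤ n → i ≤ n ∸ 1 → i < n
≤∸1⇒< {n = suc n} _ i≤n = s≤s i≤n

<⇒≤∸1 : ∀ {i n} → i < n → i ≤ n ∸ 1
<⇒≤∸1 (s≤s i≤n) = i≤n

Conclusion : ℕ → (ℕ → ℕ) → Set
Conclusion N w = NOccurrence N w (4 ∷ 3 ∷ 5 ∷ 1 ∷ 2 ∷ [])
               ⊎ (NOccurrence N w (3 ∷ 4 ∷ 5 ∷ 1 ∷ 2 ∷ [])
               ⊎ NOccurrence N w (3 ∷ 5 ∷ 4 ∷ 1 ∷ 2 ∷ []))

module Occurrence3412
  {N : ℕ} {w : ℕ → ℕ} (perm : IsPerm N w)
  (avoids-45231 : Avoids N w (4 ∷ 5 ∷ 2 ∷ 3 ∷ 1 ∷ []))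
  (avoids-45132 : Avoids N w (4 ∷ 5 ∷ 1 ∷ 3 ∷ 2 ∷ []))
  {j : ℕ} (1≤j : 1 ≤ j) (j≤N : j ≤ N) (wj≡N : w j ≡ N)
  {p₁ p₃ p₄ : ℕ} (1≤p₁ : 1 ≤ p₁) (p₁<j : p₁ < j) (j<p₃ : j < p₃) (p₃<p₄ : p₃ < p₄) (p₄≤N : p₄ ≤ N)
  (b<c : w p₃ < w p₄) (c<a : w p₄ < w p₁) (a<N : w p₁ < N)
  where

  a b c : ℕ
  a = w p₁
  b = w p₃
  c = w p₄

  1≤w : ∀ {q} → 1 ≤ q → q ≤ N → 1 ≤ w q
  1≤w {q} 1≤q q≤N = proj₁ (proj₁ perm q 1≤q q≤N)

  w-injective : ∀ {q r} → 1 ≤ q → q ≤ N → 1 ≤ r → r ≤ N → w q ≡ w r → q ≡ r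
  w-injective = proj₂ perm _ _

  1≤p₃ : 1 ≤ p₃
  1≤p₃ = ≤-trans 1≤j (<⇒≤ j<p₃)

  p₃≤N : p₃ ≤ N
  p₃≤N = ≤-trans (<⇒≤ p₃<p₄) p₄≤N

  0<b : 0 < b
  0<b = 1≤w 1≤p₃ p₃≤N

  Big : ℕ → Set
  Big q = a < w q × w q < N

  big? : Decidable Big
  big? q = (a <? w q) ×-dec (w q <? N)

  big-before-N : ∀ {q} → 1 ≤ q → q < j → Big q →
                 NOccurrence N w (4 ∷ 3 ∷ 5 ∷ 1 ∷ 2 ∷ []) ⊎ NOccurrence N w (3 ∷ 4 ∷ 5 ∷ 1 ∷ 2 ∷ [])
  big-before-N {q} 1≤q q<j (a<wq , wq<N) with <-cmp q p₁
  ... | tri< q<p₁ _ _ = inj₁ (occurrence⁵ 4 3 5 1 2 1≤q (q<p₁ ∷ p₁<j ∷ j<p₃ ∷ p₃<p₄ ∷ [-]) p₄≤N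
                                (0<b ∷ b<c ∷ c<a ∷ a<wq ∷ wq<N ∷ [-]) refl refl wj≡N refl refl
                            , fs (fs f0) , wj≡N)
  ... | tri≈ _ refl _ = contradiction a<wq (<-irrefl refl)
  ... | tri> _ _ p₁<q = inj₂ (occurrence⁵ 3 4 5 1 2 1≤p₁ (p₁<q ∷ q<j ∷ j<p₃ ∷ p₃<p₄ ∷ [-]) p₄≤N
                                (0<b ∷ b<c ∷ c<a ∷ a<wq ∷ wq<N ∷ [-]) refl refl wj≡N refl refl
                            , fs (fs f0) , wj≡N)

  big-then-ascent : ∀ {q r₁ r₂} → j < q → q < r₁ → r₁ < r₂ → r₂ ≤ N → Big q →
                    0 < w r₁ → w r₁ < w r₂ → w r₂ < a → NOccurrence N w (3 ∷ 5 ∷ 4 ∷ 1 ∷ 2 ∷ [])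
  big-then-ascent j<q q<r₁ r₁<r₂ r₂≤N (a<wq , wq<N) 0<wr₁ wr₁<wr₂ wr₂<a =
    occurrence⁵ 3 5 4 1 2 1≤p₁ (p₁<j ∷ j<q ∷ q<r₁ ∷ r₁<r₂ ∷ [-]) r₂≤N
      (0<wr₁ ∷ wr₁<wr₂ ∷ wr₂<a ∷ a<wq ∷ wq<N ∷ [-]) refl wj≡N refl refl refl , fs f0 , wj≡N

  large-after-p₄ : ∀ {q} → p₄ < q → q ≤ N → c ≤ w q
  large-after-p₄ {q} p₄<q q≤N = ≮⇒≥ small-after
    where
    p₃<q = <-trans p₃<p₄ p₄<q
    1≤q  = ≤-trans 1≤p₃ (<⇒≤ p₃<q)
    small-after : ¬ w q < c
    small-after wq<c with <-cmp (w q) b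
    ... | tri< wq<b _ _ = avoids-45231 (occurrence⁵ 4 5 2 3 1 1≤p₁ (p₁<j ∷ j<p₃ ∷ p₃<p₄ ∷ p₄<q ∷ [-]) q≤N
                            (1≤w 1≤q q≤N ∷ wq<b ∷ b<c ∷ c<a ∷ a<N ∷ [-]) refl wj≡N refl refl refl)
    ... | tri≈ _ wq≡b _ = contradiction (w-injective 1≤q q≤N 1≤p₃ p₃≤N wq≡b) (>⇒≢ p₃<q)
    ... | tri> _ _ b<wq = avoids-45132 (occurrence⁵ 4 5 1 3 2 1≤p₁ (p₁<j ∷ j<p₃ ∷ p₃<p₄ ∷ p₄<q ∷ [-]) q≤N
                            (0<b ∷ b<wq ∷ wq<c ∷ c<a ∷ a<N ∷ [-]) refl wj≡N refl refl refl)

  NewrepWitness : Set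
  NewrepWitness = ∃ λ k → InNewrep N w j k × a ≡ M (wbar w j) k × c ≡ m (N ∸ 1) (wbar w j) k

  module _ {k} (p₃≤t : p₃ ≤ suc k) (t<p₄ : suc k < p₄) (wt<c : w (suc k) < c)
           (last : ∀ {r} → suc k < r → r < p₄ → ¬ w r < c) where

    t≤N : suc k ≤ N
    t≤N = ≤-trans (<⇒≤ t<p₄) p₄≤N

    big-after-N : ∀ {q} → j < q → q < suc k → Big q → NOccurrence N w (3 ∷ 5 ∷ 4 ∷ 1 ∷ 2 ∷ [])
    big-after-N {q} j<q q<t big with <-cmp q p₃
    ... | tri< q<p₃ _ _ = big-then-ascent j<q q<p₃ p₃<p₄ p₄≤N big 0<b b<c c<a
    ... | tri≈ _ refl _ = contradiction (proj₁ big) (<⇒≯ (<-trans b<c c<a))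
    ... | tri> _ _ _    = big-then-ascent j<q q<t t<p₄ p₄≤N big (1≤w (s≤s z≤n) t≤N) wt<c c<a

    module _ (no-big-before : ∀ {q} → 1 ≤ q → q < j → ¬ Big q)
             (no-big-after : ∀ {q} → j < q → q < suc k → ¬ Big q) where

      small-up-to-t : ∀ {q} → 1 ≤ q → q ≤ suc k → q ≢ j → w q ≤ a
      small-up-to-t {q} 1≤q q≤t q≢j = ≮⇒≥ λ a<wq → not-big (a<wq , wq<N)
        where
        q≤N = ≤-trans q≤t t≤N
        wq<N : w q < N
        wq<N = ≤∧≢⇒< (proj₂ (proj₁ perm q 1≤q q≤N))
                      λ wq≡N → q≢j (w-injective 1≤q q≤N 1≤j j≤N (trans wq≡N (sym wj≡N)))
        not-big : ¬ Big q
        not-big with <-cmp q j | m≤n⇒m<n∨m≡n q≤t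
        ... | tri< q<j _ _ | _         = no-big-before 1≤q q<j
        ... | tri≈ _ q≡j _ | _         = contradiction q≡j q≢j
        ... | tri> _ _ j<q | inj₁ q<t  = no-big-after j<q q<t
        ... | tri> _ _ _   | inj₂ refl = λ (a<wt , _) → <-asym a<wt (<-trans wt<c c<a)

      large-after-t : ∀ {q} → suc k < q → q ≤ N → c ≤ w q
      large-after-t {q} t<q q≤N with <-cmp q p₄
      ... | tri< q<p₄ _ _ = ≮⇒≥ (last t<q q<p₄)
      ... | tri≈ _ refl _ = ≤-refl
      ... | tri> _ _ p₄<q = large-after-p₄ p₄<q q≤N

      j≤k : j ≤ k
      j≤k = ≤-pred (<-≤-trans j<p₃ p₃≤t)

      p₁≤k : p₁ ≤ k
      p₁≤k = <⇒≤ (<-≤-trans p₁<j j≤k)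

      M≡a : M (wbar w j) k ≡ a
      M≡a = M≡ (wbar w j) k bound 1≤p₁ p₁≤k (wbar-< w p₁<j)
        where
        bound : ∀ i → 1 ≤ i → i ≤ k → wbar w j i ≤ a
        bound i 1≤i i≤k rewrite wbar≡w∘punchIn w j i =
          let i≤p , p≤1+i = punchIn-bounds j i
          in small-up-to-t (≤-trans 1≤i i≤p) (≤-trans p≤1+i (s≤s i≤k)) (punchIn-≢ j i)

      -- p₄ is the position in w of the letter of w̄ at i₀.
      i₀ : ℕ
      i₀ = pred p₄

      1+i₀≡p₄ : suc i₀ ≡ p₄
      1+i₀≡p₄ = suc-pred p₄ {{>-nonZero (<-≤-trans z<s p₃<p₄)}}

      k<i₀ : k < i₀
      k<i₀ = ≤-pred (subst (suc (suc k) ≤_) (sym 1+i₀≡p₄) t<p₄)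

      i₀≤N∸1 : i₀ ≤ N ∸ 1
      i₀≤N∸1 = <⇒≤∸1 (subst (_≤ N) (sym 1+i₀≡p₄) p₄≤N)

      wbar-i₀≡c : wbar w j i₀ ≡ c
      wbar-i₀≡c = trans (wbar-≥ w (≤-trans j≤k (<⇒≤ k<i₀))) (cong w 1+i₀≡p₄)

      m≡c : m (N ∸ 1) (wbar w j) k ≡ c
      m≡c = m≡ (N ∸ 1) (wbar w j) k bound k<i₀ i₀≤N∸1 wbar-i₀≡c
        where
        bound : ∀ i → k < i → i ≤ N ∸ 1 → c ≤ wbar w j i
        bound i k<i i≤N∸1 rewrite wbar-≥ w (≤-trans j≤k (<⇒≤ k<i)) =
          large-after-t (s≤s k<i) (≤∸1⇒< (≤-trans 1≤j j≤N) i≤N∸1)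

      k∈newrep : InNewrep N w j k
      k∈newrep = descent⇒InSupp (wbar-perm perm 1≤j j≤N wj≡N) 1≤p₁ p₁≤k k<i₀ i₀≤N∸1
                   (subst₂ _<_ (sym wbar-i₀≡c) (sym (wbar-< w p₁<j)) c<a) , j≤k

      newrep-witness : NewrepWitness
      newrep-witness = k , k∈newrep , sym M≡a , sym m≡c

  conclusion : ¬ NewrepWitness → Conclusion N w
  conclusion no-k with greatest (λ r → w r <? c) p₃<p₄ b<c
  ... | zero  , p₃≤0 , _ = contradiction (≤-trans 1≤p₃ p₃≤0) λ ()
  ... | suc k , p₃≤t , t<p₄ , wt<c , last
      with anyUpTo? (λ q → (1 ≤? q) ×-dec big? q) j | anyUpTo? (λ q → (j <? q) ×-dec big? q) (suc k)
  ... | yes (q , q<j , 1≤q , big) | _ = map₂ inj₁ (big-before-N 1≤q q<j big)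
  ... | no _ | yes (q , q<t , j<q , big) = inj₂ (inj₂ (big-after-N p₃≤t t<p₄ wt<c last j<q q<t big))
  ... | no none-before | no none-after = contradiction
    (newrep-witness p₃≤t t<p₄ wt<c last
       (λ {q} 1≤q q<j big → none-before (q , q<j , 1≤q , big))
       (λ {q} j<q q<t big → none-after (q , q<t , j<q , big)))
    no-k

proposition4p2p5 : (N : ℕ) (w : ℕ → ℕ) → IsPerm N w
    → Avoids N w (4 ∷ 5 ∷ 2 ∷ 3 ∷ 1 ∷ [])
    → Avoids N w (4 ∷ 5 ∷ 1 ∷ 3 ∷ 2 ∷ [])
    → (j : ℕ) → 1 ≤ j → j ≤ N → w j ≡ N
    → (o : Occurrence N w (3 ∷ 4 ∷ 1 ∷ 2 ∷ []))
    → Occurrence.pos o (fs f0) ≡ j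
    → ¬ (∃ λ k → InNewrep N w j k
           × w (Occurrence.pos o f0) ≡ M (wbar w j) k
           × w (Occurrence.pos o (fs (fs (fs f0)))) ≡ m (N ∸ 1) (wbar w j) k)
    → NOccurrence N w (4 ∷ 3 ∷ 5 ∷ 1 ∷ 2 ∷ [])
      ⊎ (NOccurrence N w (3 ∷ 4 ∷ 5 ∷ 1 ∷ 2 ∷ [])
      ⊎ NOccurrence N w (3 ∷ 5 ∷ 4 ∷ 1 ∷ 2 ∷ []))
proposition4p2p5 N w perm avoids-45231 avoids-45132 j 1≤j j≤N wj≡N o pos₂≡j =
  Occurrence3412.conclusion perm avoids-45231 avoids-45132 1≤j j≤N wj≡N
    (pos-low f0) (at-j (pos-incr f0 (fs f0) z<s)) (at-j′ (pos-incr (fs f0) (fs (fs f0)) (s<s z<s)))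
    (pos-incr (fs (fs f0)) (fs (fs (fs f0))) (s<s (s<s z<s))) (pos-high (fs (fs (fs f0))))
    (from (order (fs (fs f0)) (fs (fs (fs f0)))) ≤-refl)
    (from (order (fs (fs (fs f0))) f0) ≤-refl)
    (subst (w (pos f0) <_) (trans (cong w pos₂≡j) wj≡N) (from (order f0 (fs f0)) ≤-refl))
  where
  open Occurrence o
  open Equivalence using (from)
  at-j : ∀ {x} → x < pos (fs f0) → x < j
  at-j = subst (_ <_) pos₂≡j
  at-j′ : ∀ {x} → pos (fs f0) < x → j < x
  at-j′ = subst (_< _) pos₂≡j
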